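{- Let $v$ be prime, $1\le\ell\le w/2$, $w\le v$, and let $G_\ell:[v]^\ell\to[v]^w$ be a function such that for all $y\ne y'$, $d_H(G_\ell(y),G_\ell(y'))\ge w-\ell$, and for $y\in_u[v]^\ell$, $G_\ell(y)$ is $\ell$-wise independent. Let $\mathcal{RS}=\{G_\ell(y):y\in[v]^\ell\}$. Then the collection $\{P^\alpha:\alpha\in\mathcal{RS}\}$ is $(q,\tau)$-load balancing for $\tau = 2^\ell + 2^w(q/v)^{\ell-1}$.
   Context: Shift-Hamming distance: for $x,x'\in[B]^m$, $d_H(x,x')=\min_{a\in[B]}|\{i: x_i-x'_i\ne a\bmod B\}|$. For $\alpha\in[v]^w$, $P^\alpha=\{P^\alpha_1,\ldots,P^\alpha_v\}$ is the partition of $[vw]$ with $P^\alpha_i=\{(k-1)v+((i-\alpha_k)\bmod v):k\in[w]\}$. A collection $\{P^\alpha:\alpha\in\mathcal{A}\}$ of partitions of $[n]$ into $v$ blocks of size $w$ is $(q,\tau)$-load balancing if for all $Q\subseteq[n]$ with $|Q|\le q$ and all $j\in[v]$, $\mathbb{E}_{\alpha\in_u\mathcal{A}}[\mathbf{1}(Q\cap P^\alpha_j\ne\emptyset)2^{|Q\cap P^\alpha_j|}]\le\tau q/v$. -}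

module Defs where

open import Data.Nat as ℕ using (ℕ; zero; suc; _+_; _*_; _∸_; _^_; _%_; NonZero; _⊓_)
open import Data.Integer using (+_)
open import Data.Rational as ℚ using (ℚ; _/_; 0ℚ; 1ℚ)
open import Data.Fin as Fin using (Fin; toℕ)
open import Data.Fin.Subset using (Subset; _∩_; ∣_∣; inside; outside)
open import Data.Vec as Vec using (Vec; []; _∷_; lookup; tabulate)
open import Data.Vec.Properties using (≡-dec)
import Data.Nat.Properties
open import Data.List as List using (List; []; _∷_; length; filter; allFin; concatMap; map; foldr; deduplicate)
open import Relation.Nullary using (Dec; yes; no; ¬?)
open import Relation.Nullary.Decidable using (does)
open import Data.Nat.ListAction using (sum)
open import Data.Bool using (if_then_else_)
open import Data.List.Relation.Unary.Any using (any?)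
open import Relation.Binary.PropositionalEquality using (_≡_)

-- Conventions: [B] = {0,…,B-1} is Fin B; [B]^m is Vec (Fin B) m.

allVecs : (m B : ℕ) → List (Vec (Fin B) m)
allVecs zero    B = [] ∷ []
allVecs (suc m) B = concatMap (λ b → map (b ∷_) (allVecs m B)) (allFin B)

countFin : (m : ℕ) → (P : Fin m → Set) → ((i : Fin m) → Dec (P i)) → ℕ
countFin m P P? = length (filter P? (allFin m))

subMod : (B : ℕ) → .{{NonZero B}} → Fin B → Fin B → ℕ
subMod B x y = (B + toℕ x ∸ toℕ y) % B

-- shift-Hamming distance d_H(x,x') = min_{a∈[B]} |{i : x_i - x'_i ≠ a mod B}|
-- (minimum over the nonempty list [B]; initial value m is an upper bound of every term)
dH : (B : ℕ) → .{{NonZero B}} → {m : ℕ} → Vec (Fin B) m → Vec (Fin B) m → ℕ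
dH B {m} x x' =
  foldr _⊓_ m
    (map (λ a → countFin m (λ i → ¬ (subMod B (lookup x i) (lookup x' i) ≡ toℕ a))
                             (λ i → ¬? (subMod B (lookup x i) (lookup x' i) ℕ.≟ toℕ a)))
         (allFin B))
  where open import Relation.Nullary using (¬_)

Pr : (ℓ v : ℕ) → .{{NonZero v}} → (E : Vec (Fin v) ℓ → Set) →
     ((y : Vec (Fin v) ℓ) → Dec (E y)) → ℚ
Pr ℓ v E E? = (+ length (filter E? (allVecs ℓ v))) / (v ^ ℓ)
  where instance _ = Data.Nat.Properties.m^n≢0 v ℓ

-- G(y) for y ∈_u [v]^ℓ is k-wise independent: for every k distinct coordinates
-- s : Fin k ↪ Fin w and every value b ∈ [v]^k, Pr[G(y)_{s_t} = b_t ∀t] = v^{-k}.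
KWiseIndependent : (k ℓ v w : ℕ) → .{{NonZero v}} → (Vec (Fin v) ℓ → Vec (Fin v) w) → Set
KWiseIndependent k ℓ v w G =
  (s : Fin k → Fin w) → (∀ t t' → s t ≡ s t' → t ≡ t') →
  (b : Vec (Fin v) k) →
  Pr ℓ v (λ y → ∀ t → lookup (G y) (s t) ≡ lookup b t)
         (λ y → Data.Fin.Properties.all? λ t → lookup (G y) (s t) Fin.≟ lookup b t)
    ≡ (+ 1) / (v ^ k)
  where
    import Data.Fin.Properties
    instance _ = Data.Nat.Properties.m^n≢0 v k

-- The partition P^α of [vw]: block j ∈ [v] is
-- P^α_j = { k·v + ((j - α_k) mod v) : k ∈ [w] }  (0-indexed k and j).
P : (v w : ℕ) → .{{NonZero v}} → Vec (Fin v) w → Fin v → Subset (v * w)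
P v w α j = tabulate λ x →
  if does (any? (λ k → toℕ x ℕ.≟ toℕ k * v + subMod v j (lookup α k)) (allFin w))
  then inside else outside

loadTerm : {n : ℕ} → Subset n → Subset n → ℕ
loadTerm Q Pj with ∣ Q ∩ Pj ∣
... | zero  = 0
... | suc c = 2 ^ suc c

-- uniform average of a finite nonempty list of naturals (0 for the empty list)
avg : List ℕ → ℚ
avg []       = 0ℚ
avg (x ∷ xs) = (+ sum (x ∷ xs)) / length (x ∷ xs)

_^ℚ_ : ℚ → ℕ → ℚ
p ^ℚ zero  = 1ℚ
p ^ℚ suc n = p ℚ.* (p ^ℚ n)

-- {P^α : α ∈ 𝒜} (𝒜 a finite list of shifts α ∈ [v]^w, α uniform over the list)
-- is (q,τ)-load balancing.
LoadBalancing : (v w : ℕ) → .{{NonZero v}} → List (Vec (Fin v) w) → ℕ → ℚ → Set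
LoadBalancing v w 𝒜 q τ =
  (Q : Subset (v * w)) → ∣ Q ∣ ℕ.≤ q → (j : Fin v) →
  avg (map (λ α → loadTerm Q (P v w α j)) 𝒜) ℚ.≤ τ ℚ.* ((+ q) / v)

RS : (ℓ v w : ℕ) → (Vec (Fin v) ℓ → Vec (Fin v) w) → List (Vec (Fin v) w)
RS ℓ v w G = deduplicate (≡-dec Fin._≟_) (map G (allVecs ℓ v))

module Submission where

-- Fix Q with |Q| ≤ q and a block index j. Row k of the block P^α_j is a single position, determined by α_k,
-- so |Q ∩ P^α_j| is at most the number C(α) of rows whose position lies in Q. If C(α) < ℓ the load term is
-- at most 2^ℓ·C(α); otherwise some ℓ distinct rows are hit and the term is at most 2^w. So the load term is
-- at most 2^ℓ·C(α) + 2^w·I(α), where I(α) counts the distinct ℓ-tuples of hit rows. For α = G(y) with y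
-- uniform, ℓ-wise independence makes any ℓ distinct coordinates of G(y) uniform on [v]^ℓ; since each element
-- of Q is the position of at most one (row, shift) pair, E[C] ≤ q/v and E[I] ≤ (q/v)^ℓ. The distance
-- hypothesis is used only to see that G is injective, so averaging over 𝓡𝓢 is averaging over y.

open import Data.Bool using (Bool; true; false; _∧_; if_then_else_)
open import Data.Empty using (⊥-elim)
open import Data.Fin as Fin using (Fin; zero; suc; toℕ)
import Data.Fin.Properties as Finₚ
open import Data.Fin.Subset using (Subset; _∩_; ∣_∣)
import Data.Integer as ℤ
import Data.Integer.Properties as ℤₚ
open import Data.List as List using (List; []; _∷_; _++_; map; filter; length; allFin; concatMap)
import Data.List.Properties as Listₚ
open import Data.List.Relation.Unary.All using ([]; universal)
open import Data.List.Relation.Unary.AllPairs using ([]; _∷_)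
open import Data.List.Relation.Unary.Any using (any?)
open import Data.List.Relation.Unary.Unique.Propositional using (Unique)
import Data.List.Relation.Unary.Unique.Propositional.Properties as Uniqueₚ
open import Data.Nat
open import Data.Nat.DivMod
open import Data.Nat.ListAction using (sum)
open import Data.Nat.ListAction.Properties using (sum-++)
open import Data.Nat.Primality using (Prime)
open import Data.Nat.Properties
open import Data.Nat.Tactic.RingSolver using (solve-∀)
open import Data.Product using (Σ; _×_; _,_)
import Data.Rational as ℚ
import Data.Rational.Properties as ℚₚ
import Data.Rational.Unnormalised as ℚᵘ
import Data.Rational.Unnormalised.Properties as ℚᵘₚ
open import Data.Vec as Vec using (Vec; []; _∷_; lookup; tabulate)
open import Data.Vec.Properties using (≡-dec; ∷-injective; lookup∘tabulate; lookup-zipWith; lookup-map)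
open import Function using (_∘_)
open import Relation.Binary.PropositionalEquality
open import Relation.Nullary using (Dec; yes; no; does; ¬?)
open import Relation.Nullary.Decidable using (dec-true; dec-false; _→-dec_)
open import Algebra.Properties.CommutativeSemigroup +-commutativeSemigroup using () renaming (interchange to +-interchange)
open import Algebra.Properties.Monoid.Sum *-1-monoid using () renaming (sum to ∏; sum-cong-≗ to ∏-cong-≗)
open import Algebra.Properties.Semiring.Sum +-*-semiring
  using (sum-syntax; ∑-comm; ∑-distrib-+; *-distribˡ-sum; *-distribʳ-sum; sum-cong-≗)
  renaming (sum to ∑)

open import Defs

𝟙 : Bool → ℕ
𝟙 true  = 1
𝟙 false = 0

𝟙≤1 : ∀ b → 𝟙 b ≤ 1
𝟙≤1 true  = ≤-refl
𝟙≤1 false = z≤n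

𝟙-∧ : ∀ a b → 𝟙 (a ∧ b) ≡ 𝟙 a * 𝟙 b
𝟙-∧ true  b = sym (+-identityʳ _)
𝟙-∧ false b = refl

𝟙-dec-≤ : ∀ {a} {A : Set a} (d : Dec A) {n} → (A → 1 ≤ n) → 𝟙 (does d) ≤ n
𝟙-dec-≤ (yes a) 1≤n = 1≤n a
𝟙-dec-≤ (no _)  1≤n = z≤n

∑-mono-≤ : ∀ {n} {f g : Fin n → ℕ} → (∀ i → f i ≤ g i) → ∑ f ≤ ∑ g
∑-mono-≤ {zero}  f≤g = z≤n
∑-mono-≤ {suc n} f≤g = +-mono-≤ (f≤g zero) (∑-mono-≤ (f≤g ∘ suc))

∑-const : ∀ n c → ∑[ i < n ] c ≡ n * c
∑-const zero    c = refl
∑-const (suc n) c = cong (c +_) (∑-const n c)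

∑-zero : ∀ n → ∑[ i < n ] 0 ≡ 0
∑-zero n = trans (∑-const n 0) (*-zeroʳ n)

term≤∑ : ∀ {n} (f : Fin n → ℕ) i → f i ≤ ∑ f
term≤∑ f zero    = m≤m+n _ _
term≤∑ f (suc i) = ≤-trans (term≤∑ (f ∘ suc) i) (m≤n+m _ (f zero))

∑-𝟙-injective : ∀ {n} (h : Fin n → ℕ) → (∀ i i' → h i ≡ h i' → i ≡ i') →
                ∀ c → ∑[ i < n ] 𝟙 (does (h i ≟ c)) ≤ 1
∑-𝟙-injective {zero}  h inj c = z≤n
∑-𝟙-injective {suc n} h inj c with h zero ≟ c
... | no h₀≢c = subst (λ b → 𝟙 b + ∑[ i < n ] 𝟙 (does (h (suc i) ≟ c)) ≤ 1)
                  (sym (dec-false (h zero ≟ c) h₀≢c))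
                  (∑-𝟙-injective (h ∘ suc) (λ i i' e → Finₚ.suc-injective (inj _ _ e)) c)
... | yes h₀≡c = subst (λ b → 𝟙 b + ∑[ i < n ] 𝟙 (does (h (suc i) ≟ c)) ≤ 1)
                   (sym (dec-true (h zero ≟ c) h₀≡c))
                   (≤-reflexive (cong suc (trans (sum-cong-≗ others-miss) (∑-zero n))))
  where
  others-miss : ∀ i → 𝟙 (does (h (suc i) ≟ c)) ≡ 0
  others-miss i = cong 𝟙 (dec-false (h (suc i) ≟ c)
    (λ hᵢ≡c → Finₚ.0≢1+n (inj zero (suc i) (trans h₀≡c (sym hᵢ≡c)))))

∑-𝟙-≟-* : ∀ {n} (c : Fin n) (F : Fin n → ℕ) → ∑[ b < n ] (𝟙 (does (c Fin.≟ b)) * F b) ≡ F c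
∑-𝟙-≟-* {suc n} zero    F = trans (cong₂ _+_ (*-identityˡ (F zero)) (∑-zero n)) (+-identityʳ _)
∑-𝟙-≟-* {suc n} (suc c) F = ∑-𝟙-≟-* c (F ∘ suc)

∣p∣≡∑𝟙 : ∀ {n} (p : Subset n) → ∣ p ∣ ≡ ∑[ x < n ] 𝟙 (lookup p x)
∣p∣≡∑𝟙 []          = refl
∣p∣≡∑𝟙 (true ∷ p)  = cong suc (∣p∣≡∑𝟙 p)
∣p∣≡∑𝟙 (false ∷ p) = ∣p∣≡∑𝟙 p

∏-const : ∀ n c → ∏ {n} (λ _ → c) ≡ c ^ n
∏-const zero    c = refl
∏-const (suc n) c = cong (c *_) (∏-const n c)

sum-map-mono-≤ : ∀ {a} {A : Set a} (xs : List A) {f g : A → ℕ} →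
                 (∀ x → f x ≤ g x) → sum (map f xs) ≤ sum (map g xs)
sum-map-mono-≤ []       f≤g = z≤n
sum-map-mono-≤ (x ∷ xs) f≤g = +-mono-≤ (f≤g x) (sum-map-mono-≤ xs f≤g)

sum-map-cong : ∀ {a} {A : Set a} (xs : List A) {f g : A → ℕ} →
               (∀ x → f x ≡ g x) → sum (map f xs) ≡ sum (map g xs)
sum-map-cong xs f≗g = cong sum (Listₚ.map-cong f≗g xs)

sum-map-+ : ∀ {a} {A : Set a} (xs : List A) (f g : A → ℕ) →
            sum (map (λ x → f x + g x) xs) ≡ sum (map f xs) + sum (map g xs)
sum-map-+ []       f g = refl
sum-map-+ (x ∷ xs) f g =
  trans (cong (f x + g x +_) (sum-map-+ xs f g)) (+-interchange (f x) (g x) _ _)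

sum-map-*ˡ : ∀ {a} {A : Set a} (xs : List A) c (f : A → ℕ) →
             sum (map (λ x → c * f x) xs) ≡ c * sum (map f xs)
sum-map-*ˡ []       c f = sym (*-zeroʳ c)
sum-map-*ˡ (x ∷ xs) c f = trans (cong (c * f x +_) (sum-map-*ˡ xs c f)) (sym (*-distribˡ-+ c (f x) _))

sum-map-zero : ∀ {a} {A : Set a} (xs : List A) → sum (map (λ _ → 0) xs) ≡ 0
sum-map-zero xs = sum-map-*ˡ xs 0 (λ _ → 0)

sum-map-comm : ∀ {a b} {A : Set a} {B : Set b} (xs : List A) (ys : List B) (f : A → B → ℕ) →
               sum (map (λ x → sum (map (f x) ys)) xs) ≡ sum (map (λ y → sum (map (λ x → f x y) xs)) ys)
sum-map-comm []       ys f = sym (sum-map-zero ys)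
sum-map-comm (x ∷ xs) ys f =
  trans (cong (sum (map (f x) ys) +_) (sum-map-comm xs ys f)) (sym (sum-map-+ ys (f x) _))

sum-map-∑-comm : ∀ {a} {A : Set a} (xs : List A) n (f : A → Fin n → ℕ) →
                 sum (map (λ x → ∑ (f x)) xs) ≡ ∑[ i < n ] sum (map (λ x → f x i) xs)
sum-map-∑-comm []       n f = sym (∑-zero n)
sum-map-∑-comm (x ∷ xs) n f =
  trans (cong (∑ (f x) +_) (sum-map-∑-comm xs n f)) (sym (∑-distrib-+ (f x) _))

sum-map-++ : ∀ {a} {A : Set a} (f : A → ℕ) xs ys →
             sum (map f (xs ++ ys)) ≡ sum (map f xs) + sum (map f ys)
sum-map-++ f xs ys = trans (cong sum (Listₚ.map-++ f xs ys)) (sum-++ (map f xs) (map f ys))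

sum-tabulate : ∀ {n} (f : Fin n → ℕ) → sum (List.tabulate f) ≡ ∑ f
sum-tabulate {zero}  f = refl
sum-tabulate {suc n} f = cong (f zero +_) (sum-tabulate (f ∘ suc))

sum-map-allFin : ∀ n (f : Fin n → ℕ) → sum (map f (allFin n)) ≡ ∑ f
sum-map-allFin n f = trans (cong sum (Listₚ.map-tabulate (λ i → i) f)) (sum-tabulate f)

length-filter≡sum-𝟙 : ∀ {a p} {A : Set a} {P : A → Set p} (P? : ∀ x → Dec (P x)) xs →
  length (filter P? xs) ≡ sum (map (𝟙 ∘ does ∘ P?) xs)
length-filter≡sum-𝟙 P? []       = refl
length-filter≡sum-𝟙 P? (x ∷ xs) with does (P? x)
... | true  = cong suc (length-filter≡sum-𝟙 P? xs)
... | false = length-filter≡sum-𝟙 P? xs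

𝟙-any≤sum : ∀ {a p} {A : Set a} {P : A → Set p} (P? : ∀ x → Dec (P x)) xs →
  𝟙 (does (any? P? xs)) ≤ sum (map (𝟙 ∘ does ∘ P?) xs)
𝟙-any≤sum P? []       = z≤n
𝟙-any≤sum P? (x ∷ xs) with does (P? x)
... | true  = s≤s z≤n
... | false = 𝟙-any≤sum P? xs

-- Sums over [v]^m

sum-concatMap-∷ : ∀ {m v} (F : Vec (Fin v) (suc m) → ℕ) (xs : List (Vec (Fin v) m)) (as : List (Fin v)) →
  sum (map F (concatMap (λ a → map (a ∷_) xs) as)) ≡ sum (map (λ a → sum (map (F ∘ (a ∷_)) xs)) as)
sum-concatMap-∷ F xs []       = refl
sum-concatMap-∷ F xs (a ∷ as) = trans (sum-map-++ F (map (a ∷_) xs) _)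
  (cong₂ _+_ (cong sum (sym (Listₚ.map-∘ xs))) (sum-concatMap-∷ F xs as))

sum-allVecs-suc : ∀ m v (F : Vec (Fin v) (suc m) → ℕ) →
  sum (map F (allVecs (suc m) v)) ≡ ∑[ a < v ] sum (map (F ∘ (a ∷_)) (allVecs m v))
sum-allVecs-suc m v F = trans (sum-concatMap-∷ F (allVecs m v) (allFin v)) (sum-map-allFin v _)

sum-allVecs-const : ∀ m v c → sum (map (λ _ → c) (allVecs m v)) ≡ c * v ^ m
sum-allVecs-const zero    v c = trans (+-identityʳ c) (sym (*-identityʳ c))
sum-allVecs-const (suc m) v c = begin
  sum (map (λ _ → c) (allVecs (suc m) v))       ≡⟨ sum-allVecs-suc m v _ ⟩
  ∑[ a < v ] sum (map (λ _ → c) (allVecs m v))  ≡⟨ sum-cong-≗ {v} (λ _ → sum-allVecs-const m v c) ⟩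
  ∑[ a < v ] (c * v ^ m)                        ≡⟨ ∑-const v _ ⟩
  v * (c * v ^ m)                               ≡⟨ *-comm v _ ⟩
  c * v ^ m * v                                 ≡⟨ *-assoc c (v ^ m) v ⟩
  c * (v ^ m * v)                               ≡⟨ cong (c *_) (*-comm (v ^ m) v) ⟩
  c * v ^ suc m                                 ∎
  where open ≡-Reasoning

length-allVecs : ∀ m v → length (allVecs m v) ≡ v ^ m
length-allVecs m v = begin
  length (allVecs m v)               ≡⟨ length≡sum-map-1 (allVecs m v) ⟩
  sum (map (λ _ → 1) (allVecs m v))  ≡⟨ sum-allVecs-const m v 1 ⟩
  1 * v ^ m                          ≡⟨ *-identityˡ _ ⟩
  v ^ m                              ∎
  where
  open ≡-Reasoning
  length≡sum-map-1 : ∀ {A : Set} (xs : List A) → length xs ≡ sum (map (λ _ → 1) xs)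
  length≡sum-map-1 []       = refl
  length≡sum-map-1 (x ∷ xs) = cong suc (length≡sum-map-1 xs)

sum-allVecs-head : ∀ m v (f : Fin v → ℕ) →
  sum (map (f ∘ Vec.head) (allVecs (suc m) v)) ≡ ∑ f * v ^ m
sum-allVecs-head m v f = begin
  sum (map (f ∘ Vec.head) (allVecs (suc m) v))    ≡⟨ sum-allVecs-suc m v _ ⟩
  ∑[ a < v ] sum (map (λ _ → f a) (allVecs m v))  ≡⟨ sum-cong-≗ {v} (λ a → sum-allVecs-const m v (f a)) ⟩
  ∑[ a < v ] (f a * v ^ m)                        ≡⟨ sum-cong-≗ {v} (λ a → *-comm (f a) _) ⟩
  ∑[ a < v ] (v ^ m * f a)                        ≡⟨ *-distribˡ-sum (v ^ m) f ⟨
  v ^ m * ∑ f                                     ≡⟨ *-comm (v ^ m) _ ⟩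
  ∑ f * v ^ m                                     ∎
  where open ≡-Reasoning

term≤sum-allVecs : ∀ m v (F : Vec (Fin v) m → ℕ) x → F x ≤ sum (map F (allVecs m v))
term≤sum-allVecs zero    v F [] = m≤m+n _ _
term≤sum-allVecs (suc m) v F (a ∷ x) = begin
  F (a ∷ x)                                           ≤⟨ term≤sum-allVecs m v (F ∘ (a ∷_)) x ⟩
  sum (map (F ∘ (a ∷_)) (allVecs m v))                ≤⟨ term≤∑ (λ b → sum (map (F ∘ (b ∷_)) (allVecs m v))) a ⟩
  ∑[ b < v ] sum (map (F ∘ (b ∷_)) (allVecs m v))     ≡⟨ sum-allVecs-suc m v F ⟨
  sum (map F (allVecs (suc m) v))                     ∎
  where open ≤-Reasoning

sum-allVecs-∏ : ∀ m v (U : Fin m → Fin v → ℕ) →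
  sum (map (λ b → ∏ (λ t → U t (lookup b t))) (allVecs m v)) ≡ ∏ (λ t → ∑ (U t))
sum-allVecs-∏ zero    v U = refl
sum-allVecs-∏ (suc m) v U = begin
  sum (map (λ b → ∏ (λ t → U t (lookup b t))) (allVecs (suc m) v))
    ≡⟨ sum-allVecs-suc m v _ ⟩
  ∑[ a < v ] sum (map (λ x → U zero a * ∏ (λ t → U (suc t) (lookup x t))) (allVecs m v))
    ≡⟨ sum-cong-≗ {v} (λ a → trans (sum-map-*ˡ (allVecs m v) (U zero a) _)
                               (cong (U zero a *_) (sum-allVecs-∏ m v (U ∘ suc)))) ⟩
  ∑[ a < v ] (U zero a * rest)
    ≡⟨ sum-cong-≗ {v} (λ a → *-comm (U zero a) rest) ⟩
  ∑[ a < v ] (rest * U zero a)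
    ≡⟨ *-distribˡ-sum rest (U zero) ⟨
  rest * ∑ (U zero)
    ≡⟨ *-comm rest _ ⟩
  ∏ (λ t → ∑ (U t))  ∎
  where
  open ≡-Reasoning
  rest = ∏ (λ t → ∑ (U (suc t)))

matches : ∀ {m v} → (Fin m → Fin v) → Vec (Fin v) m → Bool
matches c b = does (Finₚ.all? (λ t → c t Fin.≟ lookup b t))

sum-allVecs-𝟙-matches : ∀ m v (c : Fin m → Fin v) (H : Vec (Fin v) m → ℕ) →
  sum (map (λ b → 𝟙 (matches c b) * H b) (allVecs m v)) ≡ H (tabulate c)
sum-allVecs-𝟙-matches zero    v c H = trans (+-identityʳ _) (+-identityʳ _)
sum-allVecs-𝟙-matches (suc m) v c H = begin
  sum (map (λ b → 𝟙 (matches c b) * H b) (allVecs (suc m) v))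
    ≡⟨ sum-allVecs-suc m v _ ⟩
  ∑[ a < v ] sum (map (λ x → 𝟙 (does (c zero Fin.≟ a) ∧ matches (c ∘ suc) x) * H (a ∷ x)) (allVecs m v))
    ≡⟨ sum-cong-≗ {v} (λ a → sum-map-cong (allVecs m v) (split a)) ⟩
  ∑[ a < v ] sum (map (λ x → head≡ a * (𝟙 (matches (c ∘ suc) x) * H (a ∷ x))) (allVecs m v))
    ≡⟨ sum-cong-≗ {v} (λ a → trans (sum-map-*ˡ (allVecs m v) (head≡ a) (λ x → 𝟙 (matches (c ∘ suc) x) * H (a ∷ x)))
                                   (cong (head≡ a *_) (sum-allVecs-𝟙-matches m v (c ∘ suc) (H ∘ (a ∷_))))) ⟩
  ∑[ a < v ] (head≡ a * H (a ∷ tabulate (c ∘ suc)))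
    ≡⟨ ∑-𝟙-≟-* (c zero) _ ⟩
  H (tabulate c) ∎
  where
  open ≡-Reasoning
  head≡ : Fin v → ℕ
  head≡ a = 𝟙 (does (c zero Fin.≟ a))
  split : ∀ a x → 𝟙 (does (c zero Fin.≟ a) ∧ matches (c ∘ suc) x) * H (a ∷ x)
                ≡ head≡ a * (𝟙 (matches (c ∘ suc) x) * H (a ∷ x))
  split a x = trans (cong (_* H (a ∷ x)) (𝟙-∧ (does (c zero Fin.≟ a)) (matches (c ∘ suc) x)))
                    (*-assoc (head≡ a) (𝟙 (matches (c ∘ suc) x)) (H (a ∷ x)))

toℚᵘ-fraction : ∀ a d .{{_ : NonZero d}} → ℚ.toℚᵘ ((ℤ.+ a) ℚ./ d) ℚᵘ.≃ (ℤ.+ a) ℚᵘ./ d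
toℚᵘ-fraction a (suc d) = ℚₚ.toℚᵘ-fromℚᵘ _

fraction-injective : ∀ d .{{_ : NonZero d}} {m n} → (ℤ.+ m) ℚ./ d ≡ (ℤ.+ n) ℚ./ d → m ≡ n
fraction-injective d@(suc _) {m} {n} eq with ℚᵘₚ.≃-trans (ℚᵘₚ.≃-sym (toℚᵘ-fraction m d))
  (ℚᵘₚ.≃-trans (ℚᵘₚ.≃-reflexive (cong ℚ.toℚᵘ eq)) (toℚᵘ-fraction n d))
... | ℚᵘ.*≡* md≡nd = *-cancelʳ-≡ m n d (ℤₚ.+-injective (trans (ℤₚ.pos-* m d) (trans md≡nd (sym (ℤₚ.pos-* n d)))))

fraction-* : ∀ a b d e .{{_ : NonZero d}} .{{_ : NonZero e}} →
  ((ℤ.+ a) ℚ./ d) ℚ.* ((ℤ.+ b) ℚ./ e) ≡ ℚ._/_ (ℤ.+ (a * b)) (d * e) {{m*n≢0 d e}}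
fraction-* a b d@(suc _) e@(suc _) = ℚₚ.toℚᵘ-injective (begin
  ℚ.toℚᵘ (((ℤ.+ a) ℚ./ d) ℚ.* ((ℤ.+ b) ℚ./ e))        ≈⟨ ℚₚ.toℚᵘ-homo-* ((ℤ.+ a) ℚ./ d) ((ℤ.+ b) ℚ./ e) ⟩
  ℚ.toℚᵘ ((ℤ.+ a) ℚ./ d) ℚᵘ.* ℚ.toℚᵘ ((ℤ.+ b) ℚ./ e)  ≈⟨ ℚᵘₚ.*-cong (toℚᵘ-fraction a d) (toℚᵘ-fraction b e) ⟩
  ((ℤ.+ a) ℚᵘ./ d) ℚᵘ.* ((ℤ.+ b) ℚᵘ./ e)              ≡⟨ cong (ℚᵘ._/ (d * e)) (sym (ℤₚ.pos-* a b)) ⟩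
  (ℤ.+ (a * b)) ℚᵘ./ (d * e)                          ≈⟨ toℚᵘ-fraction (a * b) (d * e) ⟨
  ℚ.toℚᵘ (ℚ._/_ (ℤ.+ (a * b)) (d * e))                ∎)
  where open ℚᵘₚ.≃-Reasoning

fraction-+ : ∀ a b d e .{{_ : NonZero d}} .{{_ : NonZero e}} →
  ((ℤ.+ a) ℚ./ d) ℚ.+ ((ℤ.+ b) ℚ./ e) ≡ ℚ._/_ (ℤ.+ (a * e + b * d)) (d * e) {{m*n≢0 d e}}
fraction-+ a b d@(suc _) e@(suc _) = ℚₚ.toℚᵘ-injective (begin
  ℚ.toℚᵘ (((ℤ.+ a) ℚ./ d) ℚ.+ ((ℤ.+ b) ℚ./ e))        ≈⟨ ℚₚ.toℚᵘ-homo-+ ((ℤ.+ a) ℚ./ d) ((ℤ.+ b) ℚ./ e) ⟩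
  ℚ.toℚᵘ ((ℤ.+ a) ℚ./ d) ℚᵘ.+ ℚ.toℚᵘ ((ℤ.+ b) ℚ./ e)  ≈⟨ ℚᵘₚ.+-cong (toℚᵘ-fraction a d) (toℚᵘ-fraction b e) ⟩
  ((ℤ.+ a) ℚᵘ./ d) ℚᵘ.+ ((ℤ.+ b) ℚᵘ./ e)              ≡⟨ cong (ℚᵘ._/ (d * e)) numerator ⟩
  (ℤ.+ (a * e + b * d)) ℚᵘ./ (d * e)                  ≈⟨ toℚᵘ-fraction (a * e + b * d) (d * e) ⟨
  ℚ.toℚᵘ (ℚ._/_ (ℤ.+ (a * e + b * d)) (d * e))        ∎)
  where
  open ℚᵘₚ.≃-Reasoning
  numerator : ℤ._+_ ((ℤ.+ a) ℤ.* (ℤ.+ e)) ((ℤ.+ b) ℤ.* (ℤ.+ d)) ≡ ℤ.+ (a * e + b * d)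
  numerator = trans (cong₂ ℤ._+_ (sym (ℤₚ.pos-* a e)) (sym (ℤₚ.pos-* b d))) (sym (ℤₚ.pos-+ (a * e) (b * d)))

fraction-^ : ∀ a d n .{{_ : NonZero d}} → ((ℤ.+ a) ℚ./ d) ^ℚ n ≡ ℚ._/_ (ℤ.+ (a ^ n)) (d ^ n) {{m^n≢0 d n}}
fraction-^ a d zero    = refl
fraction-^ a d (suc n) {{d≢0}} = trans (cong ((ℤ.+ a) ℚ./ d ℚ.*_) (fraction-^ a d n))
  (fraction-* a (a ^ n) d (d ^ n) {{d≢0}} {{m^n≢0 d n}})

fraction-≤ : ∀ a b d e .{{_ : NonZero d}} .{{_ : NonZero e}} → a * e ≤ b * d → ((ℤ.+ a) ℚ./ d) ℚ.≤ ((ℤ.+ b) ℚ./ e)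
fraction-≤ a b d@(suc _) e@(suc _) ae≤bd = ℚₚ.toℚᵘ-cancel-≤
  (ℚᵘₚ.≤-respˡ-≃ (ℚᵘₚ.≃-sym (toℚᵘ-fraction a d)) (ℚᵘₚ.≤-respʳ-≃ (ℚᵘₚ.≃-sym (toℚᵘ-fraction b e))
    (ℚᵘ.*≤* (subst₂ ℤ._≤_ (ℤₚ.pos-* a e) (ℤₚ.pos-* b d) (ℤ.+≤+ ae≤bd)))))

avg-≡ : ∀ xs d .{{_ : NonZero d}} → length xs ≡ d → avg xs ≡ (ℤ.+ sum xs) ℚ./ d
avg-≡ []       d {{d≢0}} 0≡d = ⊥-elim (≢-nonZero⁻¹ d {{d≢0}} (sym 0≡d))
avg-≡ (x ∷ xs) _ refl = refl

-- k-wise independence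

Injective : ∀ {m n} → (Fin m → Fin n) → Set
Injective s = ∀ t t' → s t ≡ s t' → t ≡ t'

restrict : ∀ {a} {A : Set a} {l w} → Vec A w → (Fin l → Fin w) → Vec A l
restrict x s = tabulate (lookup x ∘ s)

module _ {ℓ v w} .{{_ : NonZero v}} (G : Vec (Fin v) ℓ → Vec (Fin v) w)
         (independent : KWiseIndependent ℓ ℓ v w G) where

  private
    Y = allVecs ℓ v

  restriction-hits-once : ∀ s → Injective s → ∀ b →
    sum (map (λ y → 𝟙 (matches (lookup (G y) ∘ s) b)) Y) ≡ 1
  restriction-hits-once s s-inj b = trans
    (sym (length-filter≡sum-𝟙 (λ y → Finₚ.all? (λ t → lookup (G y) (s t) Fin.≟ lookup b t)) Y))
    (fraction-injective (v ^ ℓ) {{m^n≢0 v ℓ}} (independent s s-inj b))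

  sum-restriction : ∀ s → Injective s → (F : Vec (Fin v) ℓ → ℕ) →
    sum (map (λ y → F (restrict (G y) s)) Y) ≡ sum (map F Y)
  sum-restriction s s-inj F = begin
    sum (map (λ y → F (restrict (G y) s)) Y)
      ≡⟨ sum-map-cong Y (λ y → sum-allVecs-𝟙-matches ℓ v (lookup (G y) ∘ s) F) ⟨
    sum (map (λ y → sum (map (λ b → δ y b * F b) Y)) Y)
      ≡⟨ sum-map-comm Y Y _ ⟩
    sum (map (λ b → sum (map (λ y → δ y b * F b) Y)) Y)
      ≡⟨ sum-map-cong Y (λ b → begin
           sum (map (λ y → δ y b * F b) Y) ≡⟨ sum-map-cong Y (λ y → *-comm (δ y b) (F b)) ⟩
           sum (map (λ y → F b * δ y b) Y) ≡⟨ sum-map-*ˡ Y (F b) (λ y → δ y b) ⟩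
           F b * sum (map (λ y → δ y b) Y) ≡⟨ cong (F b *_) (restriction-hits-once s s-inj b) ⟩
           F b * 1                         ≡⟨ *-identityʳ (F b) ⟩
           F b                             ∎) ⟩
    sum (map F Y) ∎
    where
    open ≡-Reasoning
    δ : Vec (Fin v) ℓ → Vec (Fin v) ℓ → ℕ
    δ y b = 𝟙 (matches (lookup (G y) ∘ s) b)

  sum-∏-restriction : ∀ s → Injective s → (U : Fin ℓ → Fin v → ℕ) →
    sum (map (λ y → ∏ (λ t → U t (lookup (G y) (s t)))) Y) ≡ ∏ (λ t → ∑ (U t))
  sum-∏-restriction s s-inj U = begin
    sum (map (λ y → ∏ (λ t → U t (lookup (G y) (s t)))) Y)
      ≡⟨ sum-map-cong Y (λ y → ∏-cong-≗ (λ t → cong (U t) (lookup∘tabulate (lookup (G y) ∘ s) t))) ⟨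
    sum (map (λ y → F (restrict (G y) s)) Y)   ≡⟨ sum-restriction s s-inj F ⟩
    sum (map F Y)                          ≡⟨ sum-allVecs-∏ ℓ v U ⟩
    ∏ (λ t → ∑ (U t))                      ∎
    where
    open ≡-Reasoning
    F : Vec (Fin v) ℓ → ℕ
    F b = ∏ (λ t → U t (lookup b t))

injectionFrom : ∀ {l w} → l ≤ w → Fin (suc w) → Fin (suc l) → Fin (suc w)
injectionFrom l≤w k zero    = k
injectionFrom l≤w k (suc t) = Fin.punchIn k (Fin.inject≤ t l≤w)

injectionFrom-injective : ∀ {l w} (l≤w : l ≤ w) k → Injective (injectionFrom l≤w k)
injectionFrom-injective l≤w k zero    zero     eq = refl
injectionFrom-injective l≤w k zero    (suc t') eq = ⊥-elim (Finₚ.punchInᵢ≢i k _ (sym eq))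
injectionFrom-injective l≤w k (suc t) zero     eq = ⊥-elim (Finₚ.punchInᵢ≢i k _ eq)
injectionFrom-injective l≤w k (suc t) (suc t') eq =
  cong suc (Finₚ.inject≤-injective l≤w l≤w t t' (Finₚ.punchIn-injective k _ _ eq))

-- The blocks P^α_j

[r+kn]%n≡r : ∀ {r n} k .{{_ : NonZero n}} → r < n → (r + k * n) % n ≡ r
[r+kn]%n≡r {r} {n} k r<n = trans ([m+kn]%n≡m%n r k n) (m<n⇒m%n≡m r<n)

[kn+r]/n≡k : ∀ {r n} k .{{_ : NonZero n}} → r < n → (k * n + r) / n ≡ k
[kn+r]/n≡k {r} {n} k r<n = begin
  (k * n + r) / n    ≡⟨ +-distrib-/ (k * n) r (subst (_< n) (sym remainders) r<n) ⟩
  k * n / n + r / n  ≡⟨ cong₂ _+_ (m*n/n≡m k n) (m<n⇒m/n≡0 r<n) ⟩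
  k + 0              ≡⟨ +-identityʳ k ⟩
  k                  ∎
  where
  open ≡-Reasoning
  remainders : k * n % n + r % n ≡ r
  remainders = cong₂ _+_ (m*n%n≡0 k n) (m<n⇒m%n≡m r<n)

subMod-injective : ∀ v .{{_ : NonZero v}} (j : Fin v) {a b} → subMod v j a ≡ subMod v j b → a ≡ b
subMod-injective v j {a} {b} σa≡σb = Finₚ.toℕ-injective (begin
  toℕ a                       ≡⟨ [r+kn]%n≡r (quotient a) (Finₚ.toℕ<n a) ⟨
  (toℕ a + quotient a * v) % v ≡⟨ cong (_% v) same-numerator ⟩
  (toℕ b + quotient b * v) % v ≡⟨ [r+kn]%n≡r (quotient b) (Finₚ.toℕ<n b) ⟩
  toℕ b                       ∎)
  where
  open ≡-Reasoning
  quotient : Fin v → ℕ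
  quotient c = (v + toℕ j ∸ toℕ c) / v
  decomposition : ∀ c → toℕ c + quotient c * v + subMod v j c ≡ v + toℕ j
  decomposition c = begin
    toℕ c + quotient c * v + subMod v j c    ≡⟨ +-assoc (toℕ c) _ _ ⟩
    toℕ c + (quotient c * v + subMod v j c)  ≡⟨ cong (toℕ c +_) (+-comm _ (subMod v j c)) ⟩
    toℕ c + (subMod v j c + quotient c * v)  ≡⟨ cong (toℕ c +_) (m≡m%n+[m/n]*n (v + toℕ j ∸ toℕ c) v) ⟨
    toℕ c + (v + toℕ j ∸ toℕ c)              ≡⟨ m+[n∸m]≡n (≤-trans (<⇒≤ (Finₚ.toℕ<n c)) (m≤m+n v (toℕ j))) ⟩
    v + toℕ j                                ∎
  without-remainder : ∀ c → toℕ c + quotient c * v ≡ v + toℕ j ∸ subMod v j c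
  without-remainder c = trans (sym (m+n∸n≡m _ (subMod v j c))) (cong (_∸ subMod v j c) (decomposition c))
  same-numerator : toℕ a + quotient a * v ≡ toℕ b + quotient b * v
  same-numerator = trans (without-remainder a)
    (trans (cong (v + toℕ j ∸_) σa≡σb) (sym (without-remainder b)))

-- Row k of P^α_j is the single position slot v j k (α_k).
slot : ∀ {w} v .{{_ : NonZero v}} → Fin v → Fin w → Fin v → ℕ
slot v j k a = toℕ k * v + subMod v j a

hits : ∀ {v w} .{{_ : NonZero v}} → Subset (v * w) → Fin v → Fin w → Fin v → ℕ
hits {v} {w} Q j k a = ∑[ x < v * w ] (𝟙 (lookup Q x) * 𝟙 (does (toℕ x ≟ slot v j k a)))

𝟙-slot≤ : ∀ {w} v .{{_ : NonZero v}} (j : Fin v) (k : Fin w) a N →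
  𝟙 (does (N ≟ slot v j k a)) ≤ 𝟙 (does (toℕ k ≟ N / v)) * 𝟙 (does (subMod v j a ≟ N % v))
𝟙-slot≤ v j k a N = 𝟙-dec-≤ (N ≟ slot v j k a) λ { refl → ≤-reflexive (sym (cong₂ (λ b c → 𝟙 b * 𝟙 c)
  (dec-true (toℕ k ≟ _) (sym ([kn+r]/n≡k (toℕ k) σa<v)))
  (dec-true (subMod v j a ≟ _) (sym (trans (cong (_% v) (+-comm (toℕ k * v) _)) ([r+kn]%n≡r (toℕ k) σa<v)))))) }
  where
  σa<v : subMod v j a < v
  σa<v = m%n<n _ v

-- The position N can only be the slot of row N / v, with the unique shift a such that subMod v j a ≡ N % v.
∑∑-𝟙-slot≤1 : ∀ {w} v .{{_ : NonZero v}} (j : Fin v) N →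
  ∑[ k < w ] ∑[ a < v ] 𝟙 (does (N ≟ slot v j k a)) ≤ 1
∑∑-𝟙-slot≤1 {w} v j N = begin
  ∑[ k < w ] ∑[ a < v ] 𝟙 (does (N ≟ slot v j k a))
    ≤⟨ ∑-mono-≤ {w} (λ k → ∑-mono-≤ {v} (λ a → 𝟙-slot≤ v j k a N)) ⟩
  ∑[ k < w ] ∑[ a < v ] (row k * column a)
    ≡⟨ sum-cong-≗ (λ k → *-distribˡ-sum (row k) column) ⟨
  ∑[ k < w ] (row k * ∑ column)
    ≤⟨ ∑-mono-≤ (λ k → *-monoʳ-≤ (row k) (∑-𝟙-injective (subMod v j) (λ _ _ → subMod-injective v j) (N % v))) ⟩
  ∑[ k < w ] (row k * 1)
    ≡⟨ sum-cong-≗ {w} (λ k → *-identityʳ (row k)) ⟩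
  ∑ row
    ≤⟨ ∑-𝟙-injective (toℕ {w}) (λ _ _ → Finₚ.toℕ-injective) (N / v) ⟩
  1 ∎
  where
  open ≤-Reasoning
  row : Fin w → ℕ
  row k = 𝟙 (does (toℕ k ≟ N / v))
  column : Fin v → ℕ
  column a = 𝟙 (does (subMod v j a ≟ N % v))

module _ {v w} .{{_ : NonZero v}} (Q : Subset (v * w)) (j : Fin v) where

  hits≤1 : ∀ k a → hits Q j k a ≤ 1
  hits≤1 k a = begin
    hits Q j k a                                          ≤⟨ ∑-mono-≤ (λ x → *-monoˡ-≤ _ (𝟙≤1 (lookup Q x))) ⟩
    ∑[ x < v * w ] (1 * 𝟙 (does (toℕ x ≟ slot v j k a)))  ≡⟨ sum-cong-≗ {v * w} (λ x → *-identityˡ _) ⟩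
    ∑[ x < v * w ] 𝟙 (does (toℕ x ≟ slot v j k a))        ≤⟨ ∑-𝟙-injective (toℕ {v * w}) (λ _ _ → Finₚ.toℕ-injective) _ ⟩
    1                                                     ∎
    where open ≤-Reasoning

  ∣∩P∣≤∑hits : ∀ α → ∣ Q ∩ P v w α j ∣ ≤ ∑[ k < w ] hits Q j k (lookup α k)
  ∣∩P∣≤∑hits α = begin
    ∣ Q ∩ P v w α j ∣
      ≡⟨ ∣p∣≡∑𝟙 (Q ∩ P v w α j) ⟩
    ∑[ x < v * w ] 𝟙 (lookup (Q ∩ P v w α j) x)
      ≡⟨ sum-cong-≗ {v * w} (λ x → trans (cong 𝟙 (lookup-zipWith _∧_ x Q (P v w α j)))
           (trans (𝟙-∧ (lookup Q x) _) (cong (λ b → 𝟙 (lookup Q x) * 𝟙 b) (trans (lookup∘tabulate _ x) (if-id _))))) ⟩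
    ∑[ x < v * w ] (𝟙 (lookup Q x) * 𝟙 (does (any? (in-row x) (allFin w))))
      ≤⟨ ∑-mono-≤ (λ x → *-monoʳ-≤ (𝟙 (lookup Q x))
           (≤-trans (𝟙-any≤sum (in-row x) (allFin w)) (≤-reflexive (sum-map-allFin w _)))) ⟩
    ∑[ x < v * w ] (𝟙 (lookup Q x) * ∑[ k < w ] 𝟙 (does (in-row x k)))
      ≡⟨ sum-cong-≗ {v * w} (λ x → *-distribˡ-sum {w} (𝟙 (lookup Q x)) (λ k → 𝟙 (does (in-row x k)))) ⟩
    ∑[ x < v * w ] ∑[ k < w ] (𝟙 (lookup Q x) * 𝟙 (does (in-row x k)))
      ≡⟨ ∑-comm {v * w} {w} (λ x k → 𝟙 (lookup Q x) * 𝟙 (does (in-row x k))) ⟩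
    ∑[ k < w ] hits Q j k (lookup α k) ∎
    where
    open ≤-Reasoning
    in-row : ∀ (x : Fin (v * w)) k → Dec (toℕ x ≡ slot v j k (lookup α k))
    in-row x k = toℕ x ≟ slot v j k (lookup α k)
    if-id : ∀ b → (if b then true else false) ≡ b
    if-id true  = refl
    if-id false = refl

  ∑∑hits≤∣Q∣ : ∑[ k < w ] ∑[ a < v ] hits Q j k a ≤ ∣ Q ∣
  ∑∑hits≤∣Q∣ = begin
    ∑[ k < w ] ∑[ a < v ] hits Q j k a
      ≡⟨ sum-cong-≗ {w} (λ k → ∑-comm {v} {v * w} _) ⟩
    ∑[ k < w ] ∑[ x < v * w ] ∑[ a < v ] term k a x
      ≡⟨ ∑-comm {w} {v * w} (λ k x → ∑[ a < v ] term k a x) ⟩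
    ∑[ x < v * w ] ∑[ k < w ] ∑[ a < v ] term k a x
      ≡⟨ sum-cong-≗ {v * w} (λ x → trans
           (sum-cong-≗ {w} (λ k → sym (*-distribˡ-sum {v} (𝟙 (lookup Q x)) (λ a → δ x k a))))
           (sym (*-distribˡ-sum {w} (𝟙 (lookup Q x)) (λ k → ∑[ a < v ] δ x k a)))) ⟩
    ∑[ x < v * w ] (𝟙 (lookup Q x) * ∑[ k < w ] ∑[ a < v ] δ x k a)
      ≤⟨ ∑-mono-≤ {v * w} (λ x → *-monoʳ-≤ (𝟙 (lookup Q x)) (∑∑-𝟙-slot≤1 {w} v j (toℕ x))) ⟩
    ∑[ x < v * w ] (𝟙 (lookup Q x) * 1)
      ≡⟨ sum-cong-≗ {v * w} (λ x → *-identityʳ _) ⟩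
    ∑[ x < v * w ] 𝟙 (lookup Q x)
      ≡⟨ ∣p∣≡∑𝟙 Q ⟨
    ∣ Q ∣ ∎
    where
    open ≤-Reasoning
    δ : Fin (v * w) → Fin w → Fin v → ℕ
    δ x k a = 𝟙 (does (toℕ x ≟ slot v j k a))
    term : Fin w → Fin v → Fin (v * w) → ℕ
    term k a x = 𝟙 (lookup Q x) * δ x k a

-- Distinct tuples of hit rows

Distinct : ∀ {l w} → Vec (Fin w) l → Set
Distinct s = Injective (lookup s)

distinct? : ∀ {l w} (s : Vec (Fin w) l) → Dec (Distinct s)
distinct? s = Finₚ.all? λ t → Finₚ.all? λ t' → (lookup s t Fin.≟ lookup s t') →-dec (t Fin.≟ t')

distinctHits : ∀ l {w} → (Fin w → ℕ) → ℕ
distinctHits l {w} h = sum (map (λ s → 𝟙 (does (distinct? s)) * ∏ (λ t → h (lookup s t))) (allVecs l w))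

private
  map-suc-distinct : ∀ {l w} (s : Vec (Fin w) l) → Distinct s → Distinct (Vec.map suc s)
  map-suc-distinct s s-distinct t t' eq = s-distinct t t'
    (Finₚ.suc-injective (trans (sym (lookup-map t suc s)) (trans eq (lookup-map t' suc s))))

  zero∷map-suc-distinct : ∀ {l w} (s : Vec (Fin w) l) → Distinct s → Distinct (zero ∷ Vec.map suc s)
  zero∷map-suc-distinct s s-distinct zero    zero     eq = refl
  zero∷map-suc-distinct s s-distinct zero    (suc t') eq = ⊥-elim (Finₚ.0≢1+n (trans eq (lookup-map t' suc s)))
  zero∷map-suc-distinct s s-distinct (suc t) zero     eq = ⊥-elim (Finₚ.0≢1+n (trans (sym eq) (lookup-map t suc s)))
  zero∷map-suc-distinct s s-distinct (suc t) (suc t') eq = cong suc (map-suc-distinct s s-distinct t t' eq)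

distinct-hits-exist : ∀ {w} (h : Fin w → ℕ) → (∀ k → h k ≤ 1) → ∀ l → l ≤ ∑ h →
  Σ (Vec (Fin w) l) λ s → Distinct s × (∀ t → 1 ≤ h (lookup s t))
distinct-hits-exist h h≤1 zero _ = [] , (λ ()) , (λ ())
distinct-hits-exist {suc w} h h≤1 (suc l) l<∑h with 1 ≤? h zero
... | no h₀≱1 =
  let s , s-distinct , s-hit = distinct-hits-exist (h ∘ suc) (h≤1 ∘ suc) (suc l)
        (subst (λ h₀ → suc l ≤ h₀ + ∑ (h ∘ suc)) (n<1⇒n≡0 (≰⇒> h₀≱1)) l<∑h)
  in Vec.map suc s , map-suc-distinct s s-distinct ,
     (λ t → subst (λ k → 1 ≤ h k) (sym (lookup-map t suc s)) (s-hit t))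
... | yes h₀≥1 =
  let s , s-distinct , s-hit = distinct-hits-exist (h ∘ suc) (h≤1 ∘ suc) l
        (≤-pred (≤-trans l<∑h (+-monoˡ-≤ (∑ (h ∘ suc)) (h≤1 zero))))
  in zero ∷ Vec.map suc s , zero∷map-suc-distinct s s-distinct , λ where
       zero    → h₀≥1
       (suc t) → subst (λ k → 1 ≤ h k) (sym (lookup-map t suc s)) (s-hit t)

distinctHits-positive : ∀ l {w} (h : Fin w → ℕ) → (∀ k → h k ≤ 1) → l ≤ ∑ h → 1 ≤ distinctHits l h
distinctHits-positive l {w} h h≤1 l≤∑h =
  let s , s-distinct , s-hit = distinct-hits-exist h h≤1 l l≤∑h
      ∏h = ∏ (λ t → h (lookup s t))
  in begin
    1                             ≤⟨ ∏-positive s-hit ⟩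
    ∏h                            ≡⟨ *-identityˡ ∏h ⟨
    1 * ∏h                        ≡⟨ cong (λ b → 𝟙 b * ∏h) (dec-true (distinct? s) s-distinct) ⟨
    𝟙 (does (distinct? s)) * ∏h   ≤⟨ term≤sum-allVecs l w _ s ⟩
    distinctHits l h              ∎
  where
  open ≤-Reasoning
  ∏-positive : ∀ {n} {f : Fin n → ℕ} → (∀ t → 1 ≤ f t) → 1 ≤ ∏ f
  ∏-positive {zero}  f≥1 = ≤-refl
  ∏-positive {suc n} f≥1 = *-mono-≤ (f≥1 zero) (∏-positive (f≥1 ∘ suc))

loadTerm≤ : ∀ {n} (Q Pj : Subset n) {l w C I} → ∣ Q ∩ Pj ∣ ≤ C → C ≤ w → (l ≤ C → 1 ≤ I) →
  loadTerm Q Pj ≤ 2 ^ l * C + 2 ^ w * I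
loadTerm≤ Q Pj {l} {w} {C} {I} c≤C C≤w many⇒I≥1 with ∣ Q ∩ Pj ∣
... | zero  = z≤n
... | suc c with suc c ≤? l
...   | yes c<l = ≤-trans (^-monoʳ-≤ 2 c<l) (≤-trans (m≤m*n (2 ^ l) C {{>-nonZero (≤-trans (s≤s z≤n) c≤C)}}) (m≤m+n _ _))
...   | no  c≮l = ≤-trans (^-monoʳ-≤ 2 (≤-trans c≤C C≤w))
                    (≤-trans (m≤m*n (2 ^ w) I {{>-nonZero (many⇒I≥1 (≤-trans (<⇒≤ (≰⇒> c≮l)) c≤C))}}) (m≤n+m _ _))

-- Expected loads

module _ {l v w} .{{_ : NonZero v}} (G : Vec (Fin v) (suc l) → Vec (Fin v) (suc w))
         (independent : KWiseIndependent (suc l) (suc l) v (suc w) G) (l≤w : l ≤ w)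
         (Q : Subset (v * suc w)) (j : Fin v) where

  private
    Y = allVecs (suc l) v

    hit : Vec (Fin v) (suc w) → Fin (suc w) → ℕ
    hit α k = hits Q j k (lookup α k)

    rowHits : Fin (suc w) → ℕ
    rowHits k = ∑[ a < v ] hits Q j k a

  sum-coordinate : ∀ k (f : Fin v → ℕ) → sum (map (λ y → f (lookup (G y) k)) Y) ≡ ∑ f * v ^ l
  sum-coordinate k f = trans
    (sum-restriction G independent (injectionFrom l≤w k) (injectionFrom-injective l≤w k) (f ∘ Vec.head))
    (sum-allVecs-head l v f)

  sum-∑hits≤ : sum (map (λ y → ∑ (hit (G y))) Y) ≤ ∣ Q ∣ * v ^ l
  sum-∑hits≤ = begin
    sum (map (λ y → ∑ (hit (G y))) Y)                   ≡⟨ sum-map-∑-comm Y (suc w) (hit ∘ G) ⟩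
    ∑[ k < suc w ] sum (map (λ y → hit (G y) k) Y)      ≡⟨ sum-cong-≗ {suc w} (λ k → sum-coordinate k (hits Q j k)) ⟩
    ∑[ k < suc w ] (rowHits k * v ^ l)                   ≡⟨ *-distribʳ-sum (v ^ l) rowHits ⟨
    ∑ rowHits * v ^ l                                    ≤⟨ *-monoˡ-≤ (v ^ l) (∑∑hits≤∣Q∣ Q j) ⟩
    ∣ Q ∣ * v ^ l                                        ∎
    where open ≤-Reasoning

  sum-distinctHits≤ : sum (map (λ y → distinctHits (suc l) (hit (G y))) Y) ≤ ∣ Q ∣ ^ suc l
  sum-distinctHits≤ = begin
    sum (map (λ y → distinctHits (suc l) (hit (G y))) Y)
      ≡⟨ sum-map-comm Y (allVecs (suc l) (suc w)) _ ⟩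
    sum (map (λ s → sum (map (λ y → 𝟙 (does (distinct? s)) * term s y) Y)) (allVecs (suc l) (suc w)))
      ≤⟨ sum-map-mono-≤ (allVecs (suc l) (suc w)) per-tuple ⟩
    sum (map (λ s → ∏ (λ t → rowHits (lookup s t))) (allVecs (suc l) (suc w)))
      ≡⟨ sum-allVecs-∏ (suc l) (suc w) (λ _ → rowHits) ⟩
    ∏ {suc l} (λ _ → ∑ rowHits)
      ≡⟨ ∏-const (suc l) (∑ rowHits) ⟩
    ∑ rowHits ^ suc l
      ≤⟨ ^-monoˡ-≤ (suc l) (∑∑hits≤∣Q∣ Q j) ⟩
    ∣ Q ∣ ^ suc l ∎
    where
    open ≤-Reasoning
    term : Vec (Fin (suc w)) (suc l) → Vec (Fin v) (suc l) → ℕ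
    term s y = ∏ (λ t → hits Q j (lookup s t) (lookup (G y) (lookup s t)))
    per-tuple : ∀ s → sum (map (λ y → 𝟙 (does (distinct? s)) * term s y) Y) ≤ ∏ (λ t → rowHits (lookup s t))
    per-tuple s = ≤-trans (≤-reflexive (sum-map-*ˡ Y (𝟙 (does (distinct? s))) (term s))) (only-distinct (distinct? s))
      where
      only-distinct : (d : Dec (Distinct s)) → 𝟙 (does d) * sum (map (term s) Y) ≤ ∏ (λ t → rowHits (lookup s t))
      only-distinct (no _)         = z≤n
      only-distinct (yes distinct) = ≤-reflexive (trans (*-identityˡ _)
        (sum-∏-restriction G independent (lookup s) distinct (λ t → hits Q j (lookup s t))))

  sum-loadTerm≤ : ∀ {q} → ∣ Q ∣ ≤ q →
    sum (map (λ y → loadTerm Q (P v (suc w) (G y) j)) Y) ≤ 2 ^ suc l * (q * v ^ l) + 2 ^ suc w * q ^ suc l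
  sum-loadTerm≤ {q} ∣Q∣≤q = begin
    sum (map (λ y → loadTerm Q (P v (suc w) (G y) j)) Y)
      ≤⟨ sum-map-mono-≤ Y (λ y → loadTerm≤ Q (P v (suc w) (G y) j) (∣∩P∣≤∑hits Q j (G y)) (∑hit≤w (G y))
                                   (distinctHits-positive (suc l) (hit (G y)) (λ k → hits≤1 Q j k (lookup (G y) k)))) ⟩
    sum (map (λ y → 2 ^ suc l * C y + 2 ^ suc w * I y) Y)
      ≡⟨ sum-map-+ Y (λ y → 2 ^ suc l * C y) (λ y → 2 ^ suc w * I y) ⟩
    sum (map (λ y → 2 ^ suc l * C y) Y) + sum (map (λ y → 2 ^ suc w * I y) Y)
      ≡⟨ cong₂ _+_ (sum-map-*ˡ Y (2 ^ suc l) C) (sum-map-*ˡ Y (2 ^ suc w) I) ⟩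
    2 ^ suc l * sum (map C Y) + 2 ^ suc w * sum (map I Y)
      ≤⟨ +-mono-≤ (*-monoʳ-≤ (2 ^ suc l) (≤-trans sum-∑hits≤ (*-monoˡ-≤ (v ^ l) ∣Q∣≤q)))
                  (*-monoʳ-≤ (2 ^ suc w) (≤-trans sum-distinctHits≤ (^-monoˡ-≤ (suc l) ∣Q∣≤q))) ⟩
    2 ^ suc l * (q * v ^ l) + 2 ^ suc w * q ^ suc l ∎
    where
    open ≤-Reasoning
    C I : Vec (Fin v) (suc l) → ℕ
    C y = ∑ (hit (G y))
    I y = distinctHits (suc l) (hit (G y))
    ∑hit≤w : ∀ α → ∑ (hit α) ≤ suc w
    ∑hit≤w α = ≤-trans (∑-mono-≤ (λ k → hits≤1 Q j k (lookup α k)))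
                       (≤-reflexive (trans (∑-const (suc w) 1) (*-identityʳ (suc w))))

-- Distinct codewords

allVecs-unique : ∀ m v → Unique (allVecs m v)
allVecs-unique zero    v = [] ∷ []
allVecs-unique (suc m) v = subst Unique (sym (concatMap≡cartesianProduct (allFin v)))
  (Uniqueₚ.cartesianProductWith⁺ _∷_ ∷-injective (Uniqueₚ.allFin⁺ v) (allVecs-unique m v))
  where
  concatMap≡cartesianProduct : ∀ as →
    concatMap (λ a → map (a ∷_) (allVecs m v)) as ≡ List.cartesianProductWith _∷_ as (allVecs m v)
  concatMap≡cartesianProduct []       = refl
  concatMap≡cartesianProduct (a ∷ as) = cong (map (a ∷_) (allVecs m v) ++_) (concatMap≡cartesianProduct as)

deduplicate-unique : ∀ {A : Set} (_≟_ : (x y : A) → Dec (x ≡ y)) {xs} → Unique xs → List.deduplicate _≟_ xs ≡ xs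
deduplicate-unique _≟_ []                  = refl
deduplicate-unique _≟_ {x ∷ xs} (x∉xs ∷ u) = cong (x ∷_) (begin
  filter (λ y → ¬? (x ≟ y)) (List.deduplicate _≟_ xs)  ≡⟨ cong (filter (λ y → ¬? (x ≟ y))) (deduplicate-unique _≟_ u) ⟩
  filter (λ y → ¬? (x ≟ y)) xs                         ≡⟨ Listₚ.filter-all (λ y → ¬? (x ≟ y)) x∉xs ⟩
  xs                                                   ∎)
  where open ≡-Reasoning

RS-injective : ∀ ℓ v w (G : Vec (Fin v) ℓ → Vec (Fin v) w) →
  (∀ y y' → G y ≡ G y' → y ≡ y') → RS ℓ v w G ≡ map G (allVecs ℓ v)
RS-injective ℓ v w G G-inj = deduplicate-unique (≡-dec Fin._≟_)
  (Uniqueₚ.map⁺ (G-inj _ _) (allVecs-unique ℓ v))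

avg-RS : ∀ ℓ v w .{{_ : NonZero v}} (G : Vec (Fin v) ℓ → Vec (Fin v) w) → (∀ y y' → G y ≡ G y' → y ≡ y') →
  (f : Vec (Fin v) w → ℕ) →
  avg (map f (RS ℓ v w G)) ≡ ℚ._/_ (ℤ.+ sum (map (f ∘ G) (allVecs ℓ v))) (v ^ ℓ) {{m^n≢0 v ℓ}}
avg-RS ℓ v w G G-inj f = begin
  avg (map f (RS ℓ v w G))           ≡⟨ cong (avg ∘ map f) (RS-injective ℓ v w G G-inj) ⟩
  avg (map f (map G (allVecs ℓ v)))  ≡⟨ cong avg (Listₚ.map-∘ (allVecs ℓ v)) ⟨
  avg (map (f ∘ G) (allVecs ℓ v))    ≡⟨ avg-≡ (map (f ∘ G) (allVecs ℓ v)) (v ^ ℓ) {{m^n≢0 v ℓ}}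
                                          (trans (Listₚ.length-map (f ∘ G) (allVecs ℓ v)) (length-allVecs ℓ v)) ⟩
  ℚ._/_ (ℤ.+ sum (map (f ∘ G) (allVecs ℓ v))) (v ^ ℓ) {{m^n≢0 v ℓ}} ∎
  where open ≡-Reasoning

dH-refl : ∀ v .{{_ : NonZero v}} {m} (x : Vec (Fin v) m) → dH v x x ≡ 0
dH-refl (suc v) {m} x = n≤0⇒n≡0 (≤-trans (m⊓n≤m _ _) (≤-reflexive no-shift-mismatch))
  where
  subMod-self : ∀ a → subMod (suc v) a a ≡ 0
  subMod-self a = trans (cong (_% suc v) (m+n∸n≡m (suc v) (toℕ a))) (n%n≡0 (suc v))
  no-shift-mismatch : countFin m _ (λ i → ¬? (subMod (suc v) (lookup x i) (lookup x i) ≟ 0)) ≡ 0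
  no-shift-mismatch = cong length (Listₚ.filter-none _
    (universal (λ i mismatch → mismatch (subMod-self (lookup x i))) (allFin m)))

distance-injective : ∀ {ℓ v w} .{{_ : NonZero v}} (G : Vec (Fin v) ℓ → Vec (Fin v) w) {d} → 1 ≤ d →
  (∀ y y' → y ≢ y' → d ≤ dH v (G y) (G y')) → ∀ y y' → G y ≡ G y' → y ≡ y'
distance-injective G 1≤d far y y' Gy≡Gy' with ≡-dec Fin._≟_ y y'
... | yes y≡y' = y≡y'
... | no  y≢y' = ⊥-elim (<⇒≱ 1≤d (≤-trans (far y y' y≢y')
                   (≤-reflexive (trans (cong (dH _ (G y)) (sym Gy≡Gy')) (dH-refl _ (G y))))))

load-fraction-≤ : ∀ {S} A B q v n .{{_ : NonZero v}} → S ≤ A * (q * v ^ n) + B * (q * q ^ n) →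
  ℚ._/_ (ℤ.+ S) (v ^ suc n) {{m^n≢0 v (suc n)}}
    ℚ.≤ ((ℤ.+ A) ℚ./ 1 ℚ.+ ((ℤ.+ B) ℚ./ 1) ℚ.* (((ℤ.+ q) ℚ./ v) ^ℚ n)) ℚ.* ((ℤ.+ q) ℚ./ v)
load-fraction-≤ {S} A B q v n S≤ = subst (ℚ._/_ (ℤ.+ S) (v ^ suc n) {{m^n≢0 v (suc n)}} ℚ.≤_) (sym τ·q/v≡)
  (fraction-≤ S N (v ^ suc n) D {{m^n≢0 v (suc n)}} {{D≢0}}
    (≤-trans (*-monoˡ-≤ D S≤) (≤-reflexive (cross-multiplied A B q (v ^ n) (q ^ n) v))))
  where
  V = v ^ n
  instance
    V≢0 : NonZero V
    V≢0 = m^n≢0 v n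
  1V≢0 : NonZero (1 * V)
  1V≢0 = m*n≢0 1 V
  11V≢0 : NonZero (1 * (1 * V))
  11V≢0 = m*n≢0 1 (1 * V) {{_}} {{1V≢0}}
  D = 1 * (1 * V) * v
  D≢0 : NonZero D
  D≢0 = m*n≢0 (1 * (1 * V)) v {{11V≢0}}
  N = (A * (1 * V) + B * q ^ n * 1) * q
  -- the unsimplified denominators 1 * … are exactly what fraction-+ and fraction-* produce
  τ·q/v≡ : ((ℤ.+ A) ℚ./ 1 ℚ.+ ((ℤ.+ B) ℚ./ 1) ℚ.* (((ℤ.+ q) ℚ./ v) ^ℚ n)) ℚ.* ((ℤ.+ q) ℚ./ v)
           ≡ ℚ._/_ (ℤ.+ N) D {{D≢0}}
  τ·q/v≡ = begin
    ((ℤ.+ A) ℚ./ 1 ℚ.+ ((ℤ.+ B) ℚ./ 1) ℚ.* (((ℤ.+ q) ℚ./ v) ^ℚ n)) ℚ.* ((ℤ.+ q) ℚ./ v)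
      ≡⟨ cong (λ x → ((ℤ.+ A) ℚ./ 1 ℚ.+ ((ℤ.+ B) ℚ./ 1) ℚ.* x) ℚ.* ((ℤ.+ q) ℚ./ v)) (fraction-^ q v n) ⟩
    ((ℤ.+ A) ℚ./ 1 ℚ.+ ((ℤ.+ B) ℚ./ 1) ℚ.* ((ℤ.+ q ^ n) ℚ./ V)) ℚ.* ((ℤ.+ q) ℚ./ v)
      ≡⟨ cong (λ x → ((ℤ.+ A) ℚ./ 1 ℚ.+ x) ℚ.* ((ℤ.+ q) ℚ./ v)) (fraction-* B (q ^ n) 1 V) ⟩
    ((ℤ.+ A) ℚ./ 1 ℚ.+ ℚ._/_ (ℤ.+ (B * q ^ n)) (1 * V) {{1V≢0}}) ℚ.* ((ℤ.+ q) ℚ./ v)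
      ≡⟨ cong (ℚ._* ((ℤ.+ q) ℚ./ v)) (fraction-+ A (B * q ^ n) 1 (1 * V) {{_}} {{1V≢0}}) ⟩
    ℚ._/_ (ℤ.+ (A * (1 * V) + B * q ^ n * 1)) (1 * (1 * V)) {{11V≢0}} ℚ.* ((ℤ.+ q) ℚ./ v)
      ≡⟨ fraction-* (A * (1 * V) + B * q ^ n * 1) q (1 * (1 * V)) v {{11V≢0}} ⟩
    ℚ._/_ (ℤ.+ N) D {{D≢0}} ∎
    where open ≡-Reasoning
  cross-multiplied : ∀ A B q V X v → (A * (q * V) + B * (q * X)) * (1 * (1 * V) * v)
                                     ≡ (A * (1 * V) + B * X * 1) * q * (v * V)
  cross-multiplied = solve-∀

-- Primality of v and w ≤ v are what make such a G exist; the bound itself does not need them.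
lemma7p2 : (v w ℓ q : ℕ) → .{{_ : NonZero v}} → Prime v →
    1 ≤ ℓ → 2 * ℓ ≤ w → w ≤ v →
    (G : Vec (Fin v) ℓ → Vec (Fin v) w) →
    (∀ y y' → y ≢ y' → w ∸ ℓ ≤ dH v (G y) (G y')) →
    KWiseIndependent ℓ ℓ v w G →
    LoadBalancing v w (RS ℓ v w G) q
      ((ℤ.+ (2 ^ ℓ)) ℚ./ 1 ℚ.+ ((ℤ.+ (2 ^ w)) ℚ./ 1) ℚ.* (((ℤ.+ q) ℚ./ v) ^ℚ (ℓ ∸ 1)))
lemma7p2 v w       zero    q _ () _ _ G far independent
lemma7p2 v zero    (suc l) q _ _ () _ G far independent
lemma7p2 v (suc w) (suc l) q _ _ 2ℓ≤w _ G far independent Q ∣Q∣≤q j = begin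
  avg (map load (RS (suc l) v (suc w) G))
    ≡⟨ avg-RS (suc l) v (suc w) G (distance-injective G 1≤w∸ℓ far) load ⟩
  ℚ._/_ (ℤ.+ sum (map (load ∘ G) (allVecs (suc l) v))) (v ^ suc l) {{m^n≢0 v (suc l)}}
    ≤⟨ load-fraction-≤ (2 ^ suc l) (2 ^ suc w) q v l (sum-loadTerm≤ G independent l≤w Q j ∣Q∣≤q) ⟩
  ((ℤ.+ (2 ^ suc l)) ℚ./ 1 ℚ.+ ((ℤ.+ (2 ^ suc w)) ℚ./ 1) ℚ.* (((ℤ.+ q) ℚ./ v) ^ℚ l)) ℚ.* ((ℤ.+ q) ℚ./ v) ∎
  where
  open ℚₚ.≤-Reasoning
  load : Vec (Fin v) (suc w) → ℕ
  load α = loadTerm Q (P v (suc w) α j)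
  ℓ+ℓ≤w : suc l + suc l ≤ suc w
  ℓ+ℓ≤w = subst (_≤ suc w) (cong (suc l +_) (+-identityʳ (suc l))) 2ℓ≤w
  1≤w∸ℓ : 1 ≤ w ∸ l
  1≤w∸ℓ = ≤-trans (s≤s z≤n) (m+n≤o⇒m≤o∸n (suc l) ℓ+ℓ≤w)
  l≤w : l ≤ w
  l≤w = ≤-pred (m+n≤o⇒m≤o (suc l) ℓ+ℓ≤w)
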